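{- Let $r<w$ be positive reals. Every deterministic online algorithm (with no restriction on memory) for the $(n,r,w)$-Parity Number of Equality Hats problem is (no better than) $(w/r)$-competitive: there is a feasible input on which the cost of its output is $w$.
   Context: An online algorithm must produce its answer $y_i$ to request $x_i$ from $x_1,\dots,x_i$ (and earlier answers) only; it is $c$-competitive if there is $\alpha\ge 0$ with $cost(A(I))\le c\cdot cost(Opt(I))+\alpha$ for all inputs $I$, $Opt$ an optimal offline algorithm. For $X=(x_1,\dots,x_m)\in\{0,1\}^m$, $EQ_m(X)=1$ if $(x_1,\dots,x_{\lfloor m/2\rfloor})=(x_{\lfloor m/2\rfloor+1},\dots,x_m)$ and $0$ otherwise. The $(n,r,w)$-Parity Number of Equality Hats problem: feasible inputs are $I=(2,X_1,2,X_2,2,X_3)$ of length $n=m_1+m_2+m_3+3$ with $m_i>1$ and $X_i\in\{0,1\}^{m_i}$. Let $y_1,y_2,y_3$ be the output bits at the three requests with value $2$ and $z_j=\bigoplus_{i=j}^{3}EQ_{m_i}(X_i)$. The cost is $r$ if $y_j=z_j$ for all $j$, and $w$ otherwise, with $r<w$. -}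

module Defs where

open import Data.Bool using (Bool; true; false; _xor_; if_then_else_)
open import Data.Bool.Properties using () renaming (_≟_ to _≟B_)
open import Data.Nat using (ℕ; zero; suc; _+_; _/_; _≡ᵇ_)
open import Data.List using (List; []; _∷_; _++_; map; take; drop; length; inits)
open import Data.List.Properties using (≡-dec)
open import Data.Rational using (ℚ)
open import Relation.Nullary.Decidable using (⌊_⌋)

-- Requests are natural numbers; feasible inputs only use 0, 1 and 2.
Request : Set
Request = ℕ

-- A deterministic online algorithm (unbounded memory): its answer at step i
-- is a function of the requests x_1,...,x_i seen so far (earlier answers are
-- themselves functions of earlier prefixes, so need not be passed).
-- The argument is the nonempty prefix (x_1,...,x_i).
OnlineAlg : Set
OnlineAlg = List Request → Bool

bit : Bool → Request
bit false = 0
bit true  = 1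

enc : List Bool → List Request
enc = map bit

input : List Bool → List Bool → List Bool → List Request
input X₁ X₂ X₃ = 2 ∷ enc X₁ ++ (2 ∷ enc X₂ ++ (2 ∷ enc X₃))

-- nonempty prefixes x_1..x_i for i = 1..length
prefixes : List Request → List (List Request)
prefixes xs with inits xs
... | [] = []
... | _ ∷ ps = ps

run : OnlineAlg → List Request → List Bool
run A I = map A (prefixes I)

answersAt2 : List Request → List Bool → List Bool
answersAt2 (x ∷ xs) (y ∷ ys) = if x ≡ᵇ 2 then y ∷ answersAt2 xs ys else answersAt2 xs ys
answersAt2 _ _ = []

EQ : List Bool → Bool
EQ X = ⌊ ≡-dec _≟B_ (take (length X / 2) X) (drop (length X / 2) X) ⌋

targets : List Bool → List Bool → List Bool → List Bool
targets X₁ X₂ X₃ =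
  (EQ X₁ xor (EQ X₂ xor EQ X₃)) ∷ (EQ X₂ xor EQ X₃) ∷ EQ X₃ ∷ []

Feasible : ℕ → List Bool → List Bool → List Bool → Set
Feasible n X₁ X₂ X₃ =
  (1 Data.Nat.< length X₁) × (1 Data.Nat.< length X₂) × (1 Data.Nat.< length X₃)
  × (n ≡ length X₁ + length X₂ + length X₃ + 3)
  where open import Data.Product using (_×_)
        open import Relation.Binary.PropositionalEquality using (_≡_)

cost : ℚ → ℚ → OnlineAlg → List Bool → List Bool → List Bool → ℚ
cost r w A X₁ X₂ X₃ =
  if ⌊ ≡-dec _≟B_ (answersAt2 I (run A I)) (targets X₁ X₂ X₃) ⌋ then r else w
  where I = input X₁ X₂ X₃

module Submission where

-- Adversary argument.  The answer y₁ at the first request (the leading 2) is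
-- produced after seeing only the prefix (2), i.e. it is a fixed bit A (2)
-- determined before any of X₁, X₂, X₃ is revealed.  The target
-- z₁ = EQ(X₁) ⊕ EQ(X₂) ⊕ EQ(X₃) however depends on X₁, and EQ is onto Bool
-- already on strings of length 2.  So the adversary fixes X₂, X₃ (padding X₂
-- so that the total length is n) and then picks a length-2 string X₁ with
-- EQ(X₁) = ¬ y₁ ⊕ EQ(X₂) ⊕ EQ(X₃), making z₁ = ¬ y₁; the algorithm is then
-- wrong at its first hat and pays w.

open import Defs
open import Data.Nat using (ℕ; _≤_; _<_; _∸_; _+_)
import Data.Nat.Properties as ℕ
open import Data.Nat.Tactic.RingSolver using (solve-∀)
open import Data.Rational using (ℚ; 0ℚ) renaming (_<_ to _<ℚ_)
open import Data.List using (List; []; _∷_; replicate; length)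
open import Data.List.Properties using (≡-dec; ∷-injectiveˡ; length-replicate)
open import Data.Bool using (Bool; true; false; not; _xor_; if_then_else_)
open import Data.Bool.Properties using (not-¬; xor-assoc; xor-same; xor-identityʳ)
  renaming (_≟_ to _≟B_)
open import Data.Product using (Σ; _×_; _,_)
open import Relation.Binary.PropositionalEquality
  using (_≡_; _≢_; refl; cong; sym; trans; module ≡-Reasoning)
open import Relation.Nullary.Decidable using (isYes≗does; dec-false)

hatAnswers : OnlineAlg → List Bool → List Bool → List Bool → List Bool
hatAnswers A X₁ X₂ X₃ = answersAt2 I (run A I)
  where I = input X₁ X₂ X₃

cost-of-wrong-answers : ∀ (r w : ℚ) A X₁ X₂ X₃ →
  hatAnswers A X₁ X₂ X₃ ≢ targets X₁ X₂ X₃ → cost r w A X₁ X₂ X₃ ≡ w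
cost-of-wrong-answers r w A X₁ X₂ X₃ wrong =
  cong (λ agrees → if agrees then r else w) (trans (isYes≗does agreement) (dec-false agreement wrong))
  where agreement = ≡-dec _≟B_ (hatAnswers A X₁ X₂ X₃) (targets X₁ X₂ X₃)

-- Online-ness: the first hat answer is A (2), given on the one-request prefix,
-- whatever X₁, X₂, X₃ are; so if it differs from z₁ the answers are wrong.
first-answer-wrong : ∀ A X₁ X₂ X₃ →
  A (2 ∷ []) ≢ EQ X₁ xor (EQ X₂ xor EQ X₃) →
  hatAnswers A X₁ X₂ X₃ ≢ targets X₁ X₂ X₃
first-answer-wrong A X₁ X₂ X₃ y₁≢z₁ agree = y₁≢z₁ (∷-injectiveˡ agree)

-- A length-2 string with prescribed value of EQ: EQ (b, 1) = [b = 1] = b.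
hat : Bool → List Bool
hat b = b ∷ true ∷ []

EQ-hat : ∀ b → EQ (hat b) ≡ b
EQ-hat true  = refl
EQ-hat false = refl

xor-cancelʳ : ∀ a c → (a xor c) xor c ≡ a
xor-cancelʳ a c = begin
  (a xor c) xor c  ≡⟨ xor-assoc a c c ⟩
  a xor (c xor c)  ≡⟨ cong (a xor_) (xor-same c) ⟩
  a xor false      ≡⟨ xor-identityʳ a ⟩
  a                ∎
  where open ≡-Reasoning

padding : ℕ → List Bool
padding n = replicate (n ∸ 7) false

feasible-padded : ∀ {n} b → 9 ≤ n → Feasible n (hat b) (padding n) (false ∷ false ∷ [])
feasible-padded {n} b 9≤n = ℕ.≤-refl , long-padding , ℕ.≤-refl , total-length
  where
  long-padding : 1 < length (padding n)
  long-padding rewrite length-replicate (n ∸ 7) {false} = ℕ.∸-monoˡ-≤ 7 9≤n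

  total-length : n ≡ 2 + length (padding n) + 2 + 3
  total-length = begin
    n                    ≡⟨ sym (ℕ.m∸n+n≡m (ℕ.≤-trans (ℕ.m≤m+n 7 2) 9≤n)) ⟩
    (n ∸ 7) + 7          ≡⟨ regroup (n ∸ 7) ⟩
    2 + (n ∸ 7) + 2 + 3  ≡⟨ cong (λ m → 2 + m + 2 + 3) (sym (length-replicate (n ∸ 7))) ⟩
    2 + length (padding n) + 2 + 3 ∎
    where
    open ≡-Reasoning
    regroup : ∀ m → m + 7 ≡ 2 + m + 2 + 3
    regroup = solve-∀

theorem7 : (n : ℕ) (r w : ℚ) → 0ℚ <ℚ r → r <ℚ w → 9 ≤ n →
    (A : OnlineAlg) →
    Σ (List Bool) λ X₁ → Σ (List Bool) λ X₂ → Σ (List Bool) λ X₃ →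
      Feasible n X₁ X₂ X₃ × cost r w A X₁ X₂ X₃ ≡ w
theorem7 n r w _ _ 9≤n A =
  X₁ , X₂ , X₃ , feasible-padded b 9≤n
     , cost-of-wrong-answers r w A X₁ X₂ X₃
         (first-answer-wrong A X₁ X₂ X₃ y₁≢z₁)
  where
  -- the first answer, committed before X₁ is revealed
  y₁ : Bool
  y₁ = A (2 ∷ [])

  X₂ X₃ : List Bool
  X₂ = padding n
  X₃ = false ∷ false ∷ []

  -- the contribution of the later blocks to z₁, and the bit X₁ must encode
  e b : Bool
  e = EQ X₂ xor EQ X₃
  b = not y₁ xor e

  X₁ : List Bool
  X₁ = hat b

  z₁≡¬y₁ : EQ X₁ xor e ≡ not y₁
  z₁≡¬y₁ = trans (cong (_xor e) (EQ-hat b)) (xor-cancelʳ (not y₁) e)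

  y₁≢z₁ : y₁ ≢ EQ X₁ xor e
  y₁≢z₁ y₁≡z₁ = not-¬ refl (trans y₁≡z₁ z₁≡¬y₁)
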